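{- Let $T$ be a tree on $n\geq 4$ vertices which is not a star graph. Then $\operatorname{Z}(\overline{T})=n-3$. Moreover, for the star graph $K_{1,n-1}$ with $n\geq 3$, $\operatorname{Z}(\overline{K_{1,n-1}})=n-1$.
   Context: All graphs are finite, simple and undirected. $\overline{G}$ denotes the complement of $G$ (same vertex set; distinct vertices adjacent iff not adjacent in $G$). The star graph $K_{1,n-1}$ is the complete bipartite graph with parts of sizes $1$ and $n-1$. Zero forcing: given an initial set $B\subseteq V(G)$ of blue vertices (all others white), a blue vertex with exactly one white neighbor may turn that neighbor blue; $B$ is a zero forcing set if repeated application makes all vertices blue. $\operatorname{Z}(G)$ is the minimum size of a zero forcing set of $G$. -}

module Defs where

open import Data.Nat using (ℕ; _≥_; _≤_; _∸_; _+_)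
open import Data.Bool using (Bool; true; false; not; _∧_)
open import Data.Fin using (Fin; _≟_)
open import Data.Fin.Subset using (Subset; inside; outside; _∈_; _∉_; ∣_∣; ⊤)
open import Data.Vec using (_[_]≔_)
open import Data.List using (List; []; _∷_; length)
open import Data.List.Relation.Unary.Unique.Propositional using (Unique)
open import Data.Product using (Σ; _×_; ∃)
open import Data.Sum using (_⊎_)
open import Relation.Nullary using (¬_; does; yes; no)
open import Relation.Binary.PropositionalEquality using (_≡_; _≢_; refl; cong; cong₂) renaming (sym to ≡-sym)
open import Data.Empty using (⊥; ⊥-elim)
open import Data.Unit using () renaming (⊤ to Unit)

record Graph (n : ℕ) : Set where
  field
    adj    : Fin n → Fin n → Bool
    sym    : ∀ u v → adj u v ≡ adj v u
    irrefl : ∀ u → adj u u ≡ false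
open Graph public

Adj : ∀ {n} → Graph n → Fin n → Fin n → Set
Adj G u v = adj G u v ≡ true

complAdj : ∀ {n} → Graph n → Fin n → Fin n → Bool
complAdj G u v = not (does (u ≟ v)) ∧ not (adj G u v)


private
  ≟-sym : ∀ {n} (u v : Fin n) → does (u ≟ v) ≡ does (v ≟ u)
  ≟-sym u v with u ≟ v | v ≟ u
  ... | yes _ | yes _ = refl
  ... | no _  | no _  = refl
  ... | yes p | no q  = ⊥-elim (q (≡-sym p))
  ... | no p  | yes q = ⊥-elim (p (≡-sym q))

  ≟-refl : ∀ {n} (u : Fin n) → does (u ≟ u) ≡ true
  ≟-refl u with u ≟ u
  ... | yes _ = refl
  ... | no p  = ⊥-elim (p refl)

complement : ∀ {n} → Graph n → Graph n
complement G = record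
  { adj    = complAdj G
  ; sym    = λ u v → cong₂ (λ a b → not a ∧ not b) (≟-sym u v) (Graph.sym G u v)
  ; irrefl = λ u → cong (λ a → not a ∧ not (adj G u u)) (≟-refl u)
  }

lastOf : ∀ {A : Set} → A → List A → A
lastOf x []       = x
lastOf x (y ∷ ys) = lastOf y ys

ConsecAdj : ∀ {n} → Graph n → List (Fin n) → Set
ConsecAdj G []            = Unit
ConsecAdj G (x ∷ [])      = Unit
ConsecAdj G (x ∷ y ∷ xs)  = Adj G x y × ConsecAdj G (y ∷ xs)

WalkFrom : ∀ {n} → Graph n → Fin n → Fin n → List (Fin n) → Set
WalkFrom G u v []       = ⊥
WalkFrom G u v (x ∷ xs) = (x ≡ u) × (lastOf x xs ≡ v) × ConsecAdj G (x ∷ xs)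

Connected : ∀ {n} → Graph n → Set
Connected {n} G = ∀ (u v : Fin n) → ∃ λ (w : List (Fin n)) → WalkFrom G u v w

IsCycle : ∀ {n} → Graph n → List (Fin n) → Set
IsCycle G []       = ⊥
IsCycle G (x ∷ xs) = (3 ≤ length (x ∷ xs)) × Unique (x ∷ xs)
                   × ConsecAdj G (x ∷ xs) × Adj G (lastOf x xs) x

Acyclic : ∀ {n} → Graph n → Set
Acyclic {n} G = ∀ (c : List (Fin n)) → ¬ IsCycle G c

IsTree : ∀ {n} → Graph n → Set
IsTree G = Connected G × Acyclic G

IsStar : ∀ {n} → Graph n → Set
IsStar {n} G = Σ (Fin n) λ c → ∀ (u v : Fin n) → u ≢ v →
                 (Adj G u v → (u ≡ c ⊎ v ≡ c)) × ((u ≡ c ⊎ v ≡ c) → Adj G u v)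

record Force {n} (G : Graph n) (B : Subset n) (u v : Fin n) : Set where
  field
    u-blue   : u ∈ B
    v-white  : v ∉ B
    uv-adj   : Adj G u v
    others   : ∀ w → Adj G u w → w ≢ v → w ∈ B

data Forces {n} (G : Graph n) : Subset n → Subset n → Set where
  done : ∀ {B} → Forces G B B
  step : ∀ {B C} u v → Force G B u v → Forces G (B [ v ]≔ inside) C → Forces G B C

IsZeroForcingSet : ∀ {n} → Graph n → Subset n → Set
IsZeroForcingSet G B = Forces G B ⊤

ZeroForcingNumber : ∀ {n} → Graph n → ℕ → Set
ZeroForcingNumber {n} G k =
  (Σ (Subset n) λ B → IsZeroForcingSet G B × ∣ B ∣ ≡ k)
  × (∀ (B : Subset n) → IsZeroForcingSet G B → k ≤ ∣ B ∣)

-- In the complement of a tree, a blue vertex u that forces v is adjacent (in the tree) to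
-- every other white vertex.  Were four vertices white, the first two forces into them would
-- give distinct forcers u, u' both tree-adjacent to the two remaining white vertices: a 4-cycle.
-- Hence Z ≥ n − 3.  A tree that is not a star contains a path a–b–c–d, necessarily induced,
-- and then b forces d, d forces a, a forces c from V ∖ {a, c, d}.  In the complement of a
-- star the centre is isolated and the rest is a clique; a zero forcing set has to contain the
-- centre and can leave out at most one leaf.
module Submission where

open import Defs hiding (sym)
open import Data.Nat using (ℕ; zero; suc; _≤_; _<_; _∸_; _+_; z≤n; s≤s)
open import Data.Nat.Properties
  using (≤-trans; ≤-pred; ≮⇒≥; +-comm; +-monoʳ-≤; m≤n+m∸n; m≤n+o⇒m∸n≤o; m+n∸m≡n)
open import Data.Bool using (true; not; _∧_)
import Data.Bool as Bool
open import Data.Bool.Properties using (¬-not; ∧-zeroʳ)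
open import Data.Fin using (Fin; zero; suc; _≟_; punchIn)
open import Data.Fin.Properties using (any?; punchInᵢ≢i; punchIn-injective)
open import Data.Fin.Subset using (Subset; Side; inside; outside; _∈_; _∉_; ∣_∣; ⊤; ∁; _-_; ⁅_⁆; Nonempty)
open import Data.Fin.Subset.Properties
  using (_∈?_; ∈⊤; ⊆⊤; ⊆-antisym; ∣⊤∣≡n; ∣∁p∣≡n∸∣p∣; x∈∁p⇒x∉p; p─⊥≡p; p─q⊆p; x∈p∧x≢y⇒x∈p-y)
open import Data.Vec using (_∷_; here; there; _[_]≔_)
open import Data.Vec.Properties using ([]≔-updates; []≔-minimal; []=⇒lookup; lookup⇒[]=; lookup∘update′)
open import Data.List using ([]; _∷_)
open import Data.List.Relation.Unary.AllPairs using ([]; _∷_)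
open import Data.List.Relation.Unary.All using ([]; _∷_)
open import Data.Product using (∃₂; _×_; _,_; proj₁; proj₂)
open import Data.Sum using (_⊎_; inj₁; inj₂)
open import Data.Unit using (tt)
open import Data.Empty using (⊥; ⊥-elim)
open import Relation.Nullary using (¬_; Dec; yes; no; does)
open import Relation.Nullary.Decidable using (dec-false; decidable-stable; _×-dec_; ¬?)
open import Relation.Binary.PropositionalEquality
  using (_≡_; _≢_; refl; sym; trans; cong; subst; ≢-sym; module ≡-Reasoning)

private
  variable
    n : ℕ
    p : Subset n
    s : Side
    u v w x y : Fin n

∈-[]≔inside : (x ≢ v → x ∈ p) → x ∈ p [ v ]≔ inside
∈-[]≔inside {x = x} {v} {p} h with x ≟ v
... | yes refl = []≔-updates p x
... | no x≢v   = []≔-minimal p x v x≢v (h x≢v)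

∈-[]≔⁻ : x ≢ v → x ∈ p [ v ]≔ s → x ∈ p
∈-[]≔⁻ {x = x} {p = p} {s = s} x≢v x∈ =
  lookup⇒[]= x p (trans (sym (lookup∘update′ x≢v p s)) ([]=⇒lookup x∈))

∉-[]≔⁺ : x ≢ v → x ∉ p → x ∉ p [ v ]≔ s
∉-[]≔⁺ x≢v x∉p x∈ = x∉p (∈-[]≔⁻ x≢v x∈)

x∉p-x : ∀ (p : Subset n) x → x ∉ p - x
x∉p-x (_ ∷ p) zero    ()
x∉p-x (_ ∷ p) (suc x) (there x∈) = x∉p-x p x x∈

∉-─⁺ : x ∉ p → x ∉ p - y
∉-─⁺ {p = p} {y = y} x∉p x∈ = x∉p (p─q⊆p p ⁅ y ⁆ x∈)

x∈p-y⁻ : x ∈ p - y → x ∈ p × x ≢ y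
x∈p-y⁻ {p = p} {y = y} x∈ = p─q⊆p p ⁅ y ⁆ x∈ , λ { refl → x∉p-x p y x∈ }

suc∣p-x∣≡∣p∣ : ∀ (p : Subset n) → x ∈ p → suc ∣ p - x ∣ ≡ ∣ p ∣
suc∣p-x∣≡∣p∣ (inside ∷ p)  here      = cong (λ q → suc ∣ q ∣) (p─⊥≡p p)
suc∣p-x∣≡∣p∣ (inside ∷ p)  (there h) = cong suc (suc∣p-x∣≡∣p∣ p h)
suc∣p-x∣≡∣p∣ (outside ∷ p) (there h) = suc∣p-x∣≡∣p∣ p h

<∣p∣⇒≤∣p-x∣ : ∀ {k} → x ∈ p → k < ∣ p ∣ → k ≤ ∣ p - x ∣
<∣p∣⇒≤∣p-x∣ x∈p k<∣p∣ = ≤-pred (subst (_ <_) (sym (suc∣p-x∣≡∣p∣ _ x∈p)) k<∣p∣)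

0<∣p∣⇒Nonempty : ∀ (p : Subset n) → 0 < ∣ p ∣ → Nonempty p
0<∣p∣⇒Nonempty (inside ∷ p)  _ = zero , here
0<∣p∣⇒Nonempty (outside ∷ p) h with a , a∈p ← 0<∣p∣⇒Nonempty p h = suc a , there a∈p

1<∣p∣⇒distinct : ∀ (p : Subset n) → 1 < ∣ p ∣ → ∃₂ λ x y → x ∈ p × y ∈ p × x ≢ y
1<∣p∣⇒distinct p 1<∣p∣
  with a , a∈p ← 0<∣p∣⇒Nonempty p (≤-trans (s≤s z≤n) 1<∣p∣)
  with b , b∈p-a ← 0<∣p∣⇒Nonempty (p - a) (<∣p∣⇒≤∣p-x∣ a∈p 1<∣p∣)
  with b∈p , b≢a ← x∈p-y⁻ b∈p-a
  = a , b , a∈p , b∈p , ≢-sym b≢a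

∣∁p∣≤k⇒n∸k≤∣p∣ : ∀ {k} (p : Subset n) → ∣ ∁ p ∣ ≤ k → n ∸ k ≤ ∣ p ∣
∣∁p∣≤k⇒n∸k≤∣p∣ {n} {k} p ∣∁p∣≤k = m≤n+o⇒m∸n≤o n k (≤-trans (m≤n+m∸n n ∣ p ∣) (begin
  ∣ p ∣ + (n ∸ ∣ p ∣) ≡⟨ cong (∣ p ∣ +_) (sym (∣∁p∣≡n∸∣p∣ p)) ⟩
  ∣ p ∣ + ∣ ∁ p ∣     ≤⟨ +-monoʳ-≤ ∣ p ∣ ∣∁p∣≤k ⟩
  ∣ p ∣ + k           ≡⟨ +-comm ∣ p ∣ k ⟩
  k + ∣ p ∣           ∎))
  where open Data.Nat.Properties.≤-Reasoning

module _ {n} (G : Graph n) where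

  adj⇒≢ : Adj G u v → u ≢ v
  adj⇒≢ {u = u} uv refl with () ← trans (sym uv) (irrefl G u)

  adj-sym : Adj G u v → Adj G v u
  adj-sym {u = u} {v} uv = trans (Graph.sym G v u) uv

  adj? : ∀ u v → Dec (Adj G u v)
  adj? u v = adj G u v Bool.≟ true

  complement-adj⁺ : u ≢ v → ¬ Adj G u v → Adj (complement G) u v
  complement-adj⁺ {u = u} {v} u≢v ¬uv rewrite dec-false (u ≟ v) u≢v | ¬-not ¬uv = refl

  complement-adj⁻ : Adj (complement G) u v → ¬ Adj G u v
  complement-adj⁻ {u = u} {v} ūv uv
    with () ← trans (sym (∧-zeroʳ (not (does (u ≟ v))))) (subst (λ b → not (does (u ≟ v)) ∧ not b ≡ true) uv ūv)

module _ {n} {H : Graph n} where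

  forces-⊤ : ∀ {B} → (∀ x → x ∈ B) → Forces H B ⊤
  forces-⊤ all-blue = subst (Forces H _) (⊆-antisym ⊆⊤ (λ {x} _ → all-blue x)) done

  isolated∈zfs : ∀ {B c} → (∀ w → ¬ Adj H w c) → Forces H B ⊤ → c ∈ B
  isolated∈zfs {c = c} isolated done = ∈⊤
  isolated∈zfs {c = c} isolated (step u v f rest) with v ≟ c
  ... | yes refl = ⊥-elim (isolated u (Force.uv-adj f))
  ... | no v≢c   = ∈-[]≔⁻ (≢-sym v≢c) (isolated∈zfs isolated rest)

  record FirstForceInto (X : Subset n) : Set where
    field
      blue     : Subset n
      forcer   : Fin n
      target   : Fin n
      target∈X : target ∈ X
      X-white  : ∀ {x} → x ∈ X → x ∉ blue
      force    : Force H blue forcer target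
      rest     : Forces H (blue [ target ]≔ inside) ⊤

  firstForceInto : ∀ {B X} → Forces H B ⊤ → (∀ {x} → x ∈ X → x ∉ B) → Nonempty X → FirstForceInto X
  firstForceInto done white (x , x∈X) = ⊥-elim (white x∈X ∈⊤)
  firstForceInto {B} {X} (step u v f rest) white nonempty with v ∈? X
  ... | yes v∈X = record
    { blue = B ; forcer = u ; target = v ; target∈X = v∈X
    ; X-white = white ; force = f ; rest = rest }
  ... | no v∉X = firstForceInto rest (λ x∈X → ∉-[]≔⁺ (λ { refl → v∉X x∈X }) (white x∈X)) nonempty

module _ {n} (G : Graph n) where

  complement-force⁺ : ∀ {B} → v ∉ B → u ≢ v → ¬ Adj G u v →
                      (∀ w → w ≢ v → ¬ Adj G u w → w ∈ B) → Force (complement G) B u v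
  complement-force⁺ {v = v} {u = u} v∉B u≢v ¬uv non-neighbours-blue = record
    { u-blue  = non-neighbours-blue u u≢v (λ uu → adj⇒≢ G uu refl)
    ; v-white = v∉B
    ; uv-adj  = complement-adj⁺ G u≢v ¬uv
    ; others  = λ w ūw w≢v → non-neighbours-blue w w≢v (complement-adj⁻ G ūw)
    }

  complement-force⇒adj : ∀ {B} → Force (complement G) B u v → w ∉ B → w ≢ v → Adj G u w
  complement-force⇒adj {u = u} {w = w} f w∉B w≢v with adj? G u w
  ... | yes uw = uw
  ... | no ¬uw = ⊥-elim (w∉B (Force.others f w (complement-adj⁺ G u≢w ¬uw) w≢v))
    where
    u≢w : u ≢ w
    u≢w refl = w∉B (Force.u-blue f)

  module _ {X} (ff : FirstForceInto {H = complement G} X) where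
    open FirstForceInto ff

    remaining-white : x ∈ X - target → x ∉ blue [ target ]≔ inside
    remaining-white x∈ = let x∈X , x≢t = x∈p-y⁻ x∈ in ∉-[]≔⁺ x≢t (X-white x∈X)

    remaining-adj : x ∈ X - target → Adj G forcer x
    remaining-adj x∈ = let x∈X , x≢t = x∈p-y⁻ x∈ in complement-force⇒adj force (X-white x∈X) x≢t

C4-free : Graph n → Set
C4-free G = ∀ {a b c d} → Adj G a b → Adj G b c → Adj G c d → Adj G d a → a ≢ c → b ≢ d → ⊥

module _ {n} (G : Graph n) (noC4 : C4-free G) where

  complement-C4-free-whites≤3 : ∀ {B} X → Forces (complement G) B ⊤ → (∀ {x} → x ∈ X → x ∉ B) → ∣ X ∣ ≤ 3
  complement-C4-free-whites≤3 X zfs white = ≮⇒≥ no-four-whites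
    where
    no-four-whites : ¬ 3 < ∣ X ∣
    no-four-whites 3<∣X∣ =
      let y , z , y∈Z , z∈Z , y≢z = 1<∣p∣⇒distinct Z 1<∣Z∣
          y∈Y , _ = x∈p-y⁻ y∈Z
          z∈Y , _ = x∈p-y⁻ z∈Z
      in noC4 (remaining-adj G ff₁ y∈Y) (adj-sym G (remaining-adj G ff₂ y∈Z))
              (remaining-adj G ff₂ z∈Z) (adj-sym G (remaining-adj G ff₁ z∈Y)) u₁≢u₂ y≢z
      where
      ff₁ : FirstForceInto {H = complement G} X
      ff₁ = firstForceInto zfs white (0<∣p∣⇒Nonempty X (≤-trans (s≤s z≤n) 3<∣X∣))
      module F₁ = FirstForceInto ff₁
      Y : Subset n
      Y = X - F₁.target
      2<∣Y∣ : 2 < ∣ Y ∣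
      2<∣Y∣ = <∣p∣⇒≤∣p-x∣ F₁.target∈X 3<∣X∣
      ff₂ : FirstForceInto {H = complement G} Y
      ff₂ = firstForceInto F₁.rest (remaining-white G ff₁) (0<∣p∣⇒Nonempty Y (≤-trans (s≤s z≤n) 2<∣Y∣))
      module F₂ = FirstForceInto ff₂
      Z : Subset n
      Z = Y - F₂.target
      1<∣Z∣ : 1 < ∣ Z ∣
      1<∣Z∣ = <∣p∣⇒≤∣p-x∣ F₂.target∈X 2<∣Y∣
      -- the second target is a G-neighbour of the first forcer but not of the second
      u₁≢u₂ : F₁.forcer ≢ F₂.forcer
      u₁≢u₂ u₁≡u₂ = complement-adj⁻ G (Force.uv-adj F₂.force)
                      (subst (λ u → Adj G u F₂.target) u₁≡u₂ (remaining-adj G ff₁ F₂.target∈X))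

  complement-C4-free-lower-bound : ∀ B → IsZeroForcingSet (complement G) B → n ∸ 3 ≤ ∣ B ∣
  complement-C4-free-lower-bound B zfs = ∣∁p∣≤k⇒n∸k≤∣p∣ B (complement-C4-free-whites≤3 (∁ B) zfs x∈∁p⇒x∉p)

module _ {n} (S : Graph n) (star : IsStar S) where
  private
    c : Fin n
    c = proj₁ star
    star-edge⁻ : ∀ u v → u ≢ v → Adj S u v → u ≡ c ⊎ v ≡ c
    star-edge⁻ u v u≢v = proj₁ (proj₂ star u v u≢v)

  complement-star-centre-isolated : ∀ w → ¬ Adj (complement S) w c
  complement-star-centre-isolated w w̄c =
    complement-adj⁻ S w̄c (proj₂ (proj₂ star w c (adj⇒≢ (complement S) w̄c)) (inj₂ refl))

  module _ {X} (ff : FirstForceInto {H = complement S} X) where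
    open FirstForceInto ff

    complement-star-second-white⇒⊥ : 1 < ∣ X ∣ → ⊥
    complement-star-second-white⇒⊥ 1<∣X∣
      with w , w∈ ← 0<∣p∣⇒Nonempty (X - target) (<∣p∣⇒≤∣p-x∣ target∈X 1<∣X∣)
      with uw ← remaining-adj S ff w∈
      with star-edge⁻ forcer w (adj⇒≢ S uw) uw
    ... | inj₁ refl = complement-star-centre-isolated target (adj-sym (complement S) (Force.uv-adj force))
    ... | inj₂ refl = remaining-white S ff w∈ (isolated∈zfs complement-star-centre-isolated rest)

  complement-star-lower-bound : ∀ B → IsZeroForcingSet (complement S) B → n ∸ 1 ≤ ∣ B ∣
  complement-star-lower-bound B zfs = ∣∁p∣≤k⇒n∸k≤∣p∣ B (≮⇒≥ λ 1<∣∁B∣ →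
    complement-star-second-white⇒⊥ (firstForceInto zfs x∈∁p⇒x∉p (0<∣p∣⇒Nonempty (∁ B) (≤-trans (s≤s z≤n) 1<∣∁B∣))) 1<∣∁B∣)

∣⊤-x∣≡n∸1 : ∀ (x : Fin n) → ∣ ⊤ - x ∣ ≡ n ∸ 1
∣⊤-x∣≡n∸1 {n} x = cong (_∸ 1) (trans (suc∣p-x∣≡∣p∣ (⊤ {n}) ∈⊤) (∣⊤∣≡n n))

edge⇒zfs : ∀ (H : Graph n) {u v} → Adj H u v → IsZeroForcingSet H (⊤ - v)
edge⇒zfs H {u} {v} uv = step u v u→v (forces-⊤ λ x → ∈-[]≔inside (x∈p∧x≢y⇒x∈p-y ∈⊤))
  where
  u→v : Force H (⊤ - v) u v
  u→v = record
    { u-blue  = x∈p∧x≢y⇒x∈p-y ∈⊤ (adj⇒≢ H uv)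
    ; v-white = x∉p-x ⊤ v
    ; uv-adj  = uv
    ; others  = λ w _ w≢v → x∈p∧x≢y⇒x∈p-y ∈⊤ w≢v
    }

record InducedP₄ (G : Graph n) (a b c d : Fin n) : Set where
  field
    ab  : Adj G a b
    bc  : Adj G b c
    cd  : Adj G c d
    ¬ac : ¬ Adj G a c
    ¬bd : ¬ Adj G b d
    ¬ad : ¬ Adj G a d

module _ {n} (G : Graph n) {a b c d} (P : InducedP₄ G a b c d) where
  open InducedP₄ P

  private
    a≢c : a ≢ c
    a≢c refl = ¬ad cd
    b≢d : b ≢ d
    b≢d refl = ¬ad ab
    a≢d : a ≢ d
    a≢d refl = ¬ac (adj-sym G cd)
    c≢d : c ≢ d
    c≢d = adj⇒≢ G cd

    B₀ : Subset n
    B₀ = ⊤ - a - c - d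

    ∈B₀ : w ≢ a → w ≢ c → w ≢ d → w ∈ B₀
    ∈B₀ w≢a w≢c w≢d = x∈p∧x≢y⇒x∈p-y (x∈p∧x≢y⇒x∈p-y (x∈p∧x≢y⇒x∈p-y ∈⊤ w≢a) w≢c) w≢d

  complement-inducedP₄-zfs : IsZeroForcingSet (complement G) (⊤ - a - c - d)
  complement-inducedP₄-zfs = step b d b→d (step d a d→a (step a c a→c (forces-⊤ λ w →
    ∈-[]≔inside λ w≢c → ∈-[]≔inside λ w≢a → ∈-[]≔inside λ w≢d → ∈B₀ w≢a w≢c w≢d)))
    where
    b→d : Force (complement G) B₀ b d
    b→d = complement-force⁺ G (x∉p-x (⊤ - a - c) d) b≢d ¬bd λ w w≢d ¬bw →
      ∈B₀ (λ { refl → ¬bw (adj-sym G ab) }) (λ { refl → ¬bw bc }) w≢d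
    d→a : Force (complement G) (B₀ [ d ]≔ inside) d a
    d→a = complement-force⁺ G (∉-[]≔⁺ a≢d (∉-─⁺ (∉-─⁺ (x∉p-x ⊤ a)))) (≢-sym a≢d) (λ da → ¬ad (adj-sym G da))
      λ w w≢a ¬dw → ∈-[]≔inside λ w≢d → ∈B₀ w≢a (λ { refl → ¬dw (adj-sym G cd) }) w≢d
    a→c : Force (complement G) (B₀ [ d ]≔ inside [ a ]≔ inside) a c
    a→c = complement-force⁺ G (∉-[]≔⁺ (≢-sym a≢c) (∉-[]≔⁺ c≢d (∉-─⁺ (x∉p-x (⊤ - a) c)))) a≢c ¬ac
      λ w w≢c _ → ∈-[]≔inside λ w≢a → ∈-[]≔inside λ w≢d → ∈B₀ w≢a w≢c w≢d

  ∣complement-inducedP₄-zfs∣ : ∣ ⊤ - a - c - d ∣ ≡ n ∸ 3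
  ∣complement-inducedP₄-zfs∣ = begin
    ∣ B₀ ∣          ≡⟨ m+n∸m≡n 3 ∣ B₀ ∣ ⟨
    3 + ∣ B₀ ∣ ∸ 3  ≡⟨ cong (_∸ 3) 3+∣B₀∣≡n ⟩
    n ∸ 3           ∎
    where
    open ≡-Reasoning
    3+∣B₀∣≡n : 3 + ∣ B₀ ∣ ≡ n
    3+∣B₀∣≡n = begin
      3 + ∣ B₀ ∣        ≡⟨ cong (2 +_) (suc∣p-x∣≡∣p∣ (⊤ - a - c) d∈⊤-a-c) ⟩
      2 + ∣ ⊤ - a - c ∣ ≡⟨ cong suc (suc∣p-x∣≡∣p∣ (⊤ - a) (x∈p∧x≢y⇒x∈p-y ∈⊤ (≢-sym a≢c))) ⟩
      1 + ∣ ⊤ - a ∣     ≡⟨ suc∣p-x∣≡∣p∣ (⊤ {n}) ∈⊤ ⟩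
      ∣ ⊤ {n} ∣         ≡⟨ ∣⊤∣≡n n ⟩
      n                 ∎
      where
      d∈⊤-a-c : d ∈ ⊤ - a - c
      d∈⊤-a-c = x∈p∧x≢y⇒x∈p-y (x∈p∧x≢y⇒x∈p-y ∈⊤ (≢-sym a≢d)) (≢-sym c≢d)

TriangleFree : Graph n → Set
TriangleFree G = ∀ {a b c} → Adj G a b → Adj G b c → Adj G c a → ⊥

Path₄ : Graph n → Fin n → Fin n → Fin n → Fin n → Set
Path₄ G a b c d = Adj G a b × Adj G b c × Adj G c d × a ≢ c × b ≢ d

∃Path₄? : ∀ (G : Graph n) → Dec (∃₂ λ a b → ∃₂ λ c d → Path₄ G a b c d)
∃Path₄? G = any? λ a → any? λ b → any? λ c → any? λ d →
  adj? G a b ×-dec adj? G b c ×-dec adj? G c d ×-dec ¬? (a ≟ c) ×-dec ¬? (b ≟ d)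

module _ {n} (G : Graph n) (acyclic : Acyclic G) where

  acyclic⇒triangle-free : TriangleFree G
  acyclic⇒triangle-free {a} {b} {c} ab bc ca = acyclic (a ∷ b ∷ c ∷ [])
    ( s≤s (s≤s (s≤s z≤n))
    , (adj⇒≢ G ab ∷ ≢-sym (adj⇒≢ G ca) ∷ []) ∷ (adj⇒≢ G bc ∷ []) ∷ [] ∷ []
    , (ab , bc , tt) , ca )

  acyclic⇒C4-free : C4-free G
  acyclic⇒C4-free {a} {b} {c} {d} ab bc cd da a≢c b≢d = acyclic (a ∷ b ∷ c ∷ d ∷ [])
    ( s≤s (s≤s (s≤s z≤n))
    , (adj⇒≢ G ab ∷ a≢c ∷ ≢-sym (adj⇒≢ G da) ∷ []) ∷ (adj⇒≢ G bc ∷ b≢d ∷ []) ∷ (adj⇒≢ G cd ∷ []) ∷ [] ∷ []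
    , (ab , bc , cd , tt) , da )

  acyclic-path₄⇒induced : ∀ {a b c d} → Path₄ G a b c d → InducedP₄ G a b c d
  acyclic-path₄⇒induced (ab , bc , cd , a≢c , b≢d) = record
    { ab = ab ; bc = bc ; cd = cd
    ; ¬ac = λ ac → acyclic⇒triangle-free ab bc (adj-sym G ac)
    ; ¬bd = λ bd → acyclic⇒triangle-free bc cd (adj-sym G bd)
    ; ¬ad = λ ad → acyclic⇒C4-free ab bc cd (adj-sym G ad) a≢c b≢d
    }

module _ {n} (G : Graph n) (connected : Connected G) where

  connected⇒edge : ∀ {u v} → u ≢ v → ∃₂ (Adj G)
  connected⇒edge {u} {v} u≢v with connected u v
  ... | x ∷ []    , refl , refl , _ = ⊥-elim (u≢v refl)
  ... | x ∷ y ∷ _ , _    , _    , xy , _ = x , y , xy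

  propagate : ∀ {P : Fin n → Set} {u} → (∀ {x y} → Adj G x y → P x → P y) → P u → ∀ v → P v
  propagate {P} {u} along-edge Pu v with connected u v
  ... | x ∷ xs , refl , refl , walk = along-walk x xs walk Pu
    where
    along-walk : ∀ x xs → ConsecAdj G (x ∷ xs) → P x → P (lastOf x xs)
    along-walk x []       _           Px = Px
    along-walk x (y ∷ ys) (xy , walk) Px = along-walk y ys walk (along-edge xy Px)

  Pendant : Fin n → Fin n → Set
  Pendant b c = Adj G b c × (∀ x → Adj G b x → x ≡ c)

  module _ (triangle-free : TriangleFree G) (path₄-free : ∀ {a b c d} → ¬ Path₄ G a b c d) where

    -- if b has a second neighbour a, then any further neighbour of c yields a triangle or a path a–b–c–d
    edge⇒pendant : Adj G u v → ∃₂ Pendant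
    edge⇒pendant {b} {c} bc with any? (λ a → adj? G b a ×-dec ¬? (a ≟ c))
    ... | no only-c = b , c , bc , λ x bx → decidable-stable (x ≟ c) λ x≢c → only-c (x , bx , x≢c)
    ... | yes (a , ba , a≢c) = c , b , adj-sym G bc , λ d cd → decidable-stable (d ≟ b) (no-other d cd)
      where
      no-other : ∀ d → Adj G c d → d ≢ b → ⊥
      no-other d cd d≢b with a ≟ d
      ... | yes refl = triangle-free (adj-sym G ba) bc cd
      ... | no _     = path₄-free (adj-sym G ba , bc , cd , a≢c , ≢-sym d≢b)

    pendant⇒star : ∀ {b c} → Pendant b c → IsStar G
    pendant⇒star {b} {c} (bc , only-c) = c , λ u v u≢v → edge⇒centre u v , centre⇒edge u v u≢v
      where
      Near : Fin n → Set
      Near x = x ≡ c ⊎ Adj G x c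

      near-along-edge : Adj G x y → Near x → Near y
      near-along-edge xy (inj₁ refl) = inj₂ (adj-sym G xy)
      near-along-edge {x} {y} xy (inj₂ xc) with y ≟ c | x ≟ b
      ... | yes y≡c | _        = inj₁ y≡c
      ... | no y≢c  | yes refl = ⊥-elim (y≢c (only-c y xy))
      ... | no y≢c  | no x≢b   = ⊥-elim (path₄-free (adj-sym G xy , xc , adj-sym G bc , y≢c , x≢b))

      near : ∀ v → Near v
      near = propagate near-along-edge (inj₂ bc)

      edge⇒centre : ∀ u v → Adj G u v → u ≡ c ⊎ v ≡ c
      edge⇒centre u v uv with near u | near v
      ... | inj₁ u≡c | _        = inj₁ u≡c
      ... | inj₂ _   | inj₁ v≡c = inj₂ v≡c
      ... | inj₂ uc  | inj₂ vc  = ⊥-elim (triangle-free uv vc (adj-sym G uc))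

      centre⇒edge : ∀ u v → u ≢ v → u ≡ c ⊎ v ≡ c → Adj G u v
      centre⇒edge u v u≢v (inj₁ refl) with near v
      ... | inj₁ refl = ⊥-elim (u≢v refl)
      ... | inj₂ vc   = adj-sym G vc
      centre⇒edge u v u≢v (inj₂ refl) with near u
      ... | inj₁ refl = ⊥-elim (u≢v refl)
      ... | inj₂ uc   = uc

non-star-tree⇒inducedP₄ : ∀ (T : Graph n) → 2 ≤ n → IsTree T → ¬ IsStar T →
                          ∃₂ λ a b → ∃₂ λ c d → InducedP₄ T a b c d
non-star-tree⇒inducedP₄ T (s≤s (s≤s z≤n)) (connected , acyclic) not-star with ∃Path₄? T
... | yes (a , b , c , d , path) = a , b , c , d , acyclic-path₄⇒induced T acyclic path
... | no no-path =
  let _ , _ , uv = connected⇒edge T connected {zero} {suc zero} (λ ())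
      _ , _ , pendant = edge⇒pendant T connected (acyclic⇒triangle-free T acyclic) path₄-free uv
  in ⊥-elim (not-star (pendant⇒star T connected (acyclic⇒triangle-free T acyclic) path₄-free pendant))
  where
  path₄-free : ∀ {a b c d} → ¬ Path₄ T a b c d
  path₄-free path = no-path (_ , _ , _ , _ , path)

complement-star-edge : ∀ (S : Graph (suc (suc (suc n)))) → IsStar S → ∃₂ (Adj (complement S))
complement-star-edge S (c , star) = leaf₁ , leaf₂ , complement-adj⁺ S leaf₁≢leaf₂ ¬leaf₁leaf₂
  where
  leaf₁ leaf₂ : Fin _
  leaf₁ = punchIn c zero
  leaf₂ = punchIn c (suc zero)
  leaf₁≢leaf₂ : leaf₁ ≢ leaf₂
  leaf₁≢leaf₂ eq with () ← punchIn-injective c zero (suc zero) eq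
  ¬leaf₁leaf₂ : ¬ Adj S leaf₁ leaf₂
  ¬leaf₁leaf₂ adjacent with proj₁ (star leaf₁ leaf₂ leaf₁≢leaf₂) adjacent
  ... | inj₁ leaf₁≡c = punchInᵢ≢i c zero leaf₁≡c
  ... | inj₂ leaf₂≡c = punchInᵢ≢i c (suc zero) leaf₂≡c

proposition2p2 :
    (∀ (n : ℕ) (T : Graph n) → 4 ≤ n → IsTree T → ¬ IsStar T →
      ZeroForcingNumber (complement T) (n ∸ 3))
    × (∀ (n : ℕ) (S : Graph n) → 3 ≤ n → IsStar S →
      ZeroForcingNumber (complement S) (n ∸ 1))
proposition2p2 = non-star-tree , star
  where
  non-star-tree : ∀ (n : ℕ) (T : Graph n) → 4 ≤ n → IsTree T → ¬ IsStar T →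
                  ZeroForcingNumber (complement T) (n ∸ 3)
  non-star-tree n T 4≤n tree not-star
    with a , b , c , d , P ← non-star-tree⇒inducedP₄ T (≤-trans (s≤s (s≤s z≤n)) 4≤n) tree not-star
    = (_ , complement-inducedP₄-zfs T P , ∣complement-inducedP₄-zfs∣ T P)
    , complement-C4-free-lower-bound T (acyclic⇒C4-free T (proj₂ tree))

  star : ∀ (n : ℕ) (S : Graph n) → 3 ≤ n → IsStar S → ZeroForcingNumber (complement S) (n ∸ 1)
  star (suc (suc (suc _))) S (s≤s (s≤s (s≤s z≤n))) is-star with _ , ℓ , uℓ ← complement-star-edge S is-star
    = (⊤ - ℓ , edge⇒zfs (complement S) uℓ , ∣⊤-x∣≡n∸1 ℓ)
    , complement-star-lower-bound S is-star
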